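{- Assume the $abc$ Conjecture. Let $\Gamma$ be a finitely generated subgroup of $\mathbb{Q}^\times$. Then there are only finitely many points $(u,v)$ with $u+v=1$ of the form $(u,v)=(sx^n,ty^m)$ with $x,y\in\mathbb{Q}$, $s,t\in\Gamma$ and integers $n,m\ge4$.
   Context: The $abc$ Conjecture: for every $\epsilon>0$ there is a constant $K_\epsilon$ such that for all coprime positive integers $a,b,c$ with $a+b=c$ one has $c<K_\epsilon\,\mathrm{rad}(abc)^{1+\epsilon}$, where $\mathrm{rad}(n)$ is the product of the distinct primes dividing $n$. -}

module Defs where

open import Data.Nat using (ℕ; zero; suc; _+_; _*_; _^_; _<_; _≤_)
open import Data.Nat.Divisibility using (_∣_; _∣?_)
open import Data.Nat.Primality using (Prime; prime?)
open import Data.Nat.Coprimality using (Coprime)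
open import Data.List using (List; upTo; filter)
open import Data.Nat.ListAction using (product)
open import Relation.Binary.PropositionalEquality using (_≡_)
open import Data.List.Membership.Propositional using (_∈_)
open import Data.Product using (Σ; ∃; _×_; _,_)
open import Relation.Nullary.Decidable using (_×-dec_)
open import Data.Rational using (ℚ; 1ℚ; NonZero) renaming (_*_ to _*ℚ_; _÷_ to _÷ℚ_)

-- radical: product of the distinct primes dividing n (primes dividing n are ≤ n for n ≥ 1;
-- we take candidates 0..n, so rad 0 = product of primes ≤ 0 ... = 1; only used for n ≥ 1)
rad : ℕ → ℕ
rad n = product (filter (λ p → prime? p ×-dec (p ∣? n)) (upTo (suc n)))

-- The abc conjecture, with ε = p/q ranging over positive rationals:
-- c < K_ε · rad(abc)^(1+p/q)  is expressed (raising to the q-th power, K absorbing K^q) as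
-- c^q < K · rad(abc)^(q+p).
ABC : Set
ABC = (p q : ℕ) → 1 ≤ p → 1 ≤ q →
      ∃ λ (K : ℕ) → (a b c : ℕ) → 1 ≤ a → 1 ≤ b → Coprime a b → a + b ≡ c →
      c ^ q < K * (rad (a * b * c)) ^ (q + p)

_^ℚ_ : ℚ → ℕ → ℚ
x ^ℚ zero = 1ℚ
x ^ℚ suc n = x *ℚ (x ^ℚ n)

data InSubgroup (gens : List ℚ) : ℚ → Set where
  one    : InSubgroup gens 1ℚ
  mulGen : ∀ {g s} → g ∈ gens → InSubgroup gens s → InSubgroup gens (g *ℚ s)
  divGen : ∀ {g s} → g ∈ gens → .{{_ : NonZero g}} → InSubgroup gens s → InSubgroup gens (s ÷ℚ g)

{-# OPTIONS --safe #-}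
-- Let S be the product of the numerators and denominators of the generators of Γ. For a prime
-- p ∤ S every element of Γ is a p-adic unit, so if p divides the numerator or the denominator
-- of s xⁿ (n ≥ 4) at all, it does so to order at least n: both are 4-powerful away from S. If u + v = 1 then u and v
-- have the same reduced denominator D and their numerators satisfy A + B = D; after sorting out
-- signs this is a coprime triple a + b = c with abc 4-powerful away from S, so
-- rad(abc)⁴ ≤ S⁴ abc ≤ S⁴ c³. The abc conjecture with ε = 1/7 gives c⁷ < K rad(abc)⁸ ≤ K S⁸ c⁶,
-- hence c < K S⁸, which bounds both |A| and D.
module Submission where

module Arithmetic where

  open import Data.Nat
  open import Data.Nat.Properties
  open import Data.Nat.Divisibility
  open import Data.Nat.Primality
  open import Data.Nat.Coprimality
    using (Coprime; coprime-divisor; 0-coprimeTo-m⇒m≡1) renaming (sym to coprime-sym)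
  open import Data.Nat.ListAction using (product)
  open import Data.Nat.Solver using (module +-*-Solver)
  open import Data.List using (List; _∷_; filter; upTo)
  open import Data.List.Relation.Unary.All as All using (All; []; _∷_)
  open import Data.List.Relation.Unary.All.Properties using (all-filter)
  open import Data.List.Relation.Unary.AllPairs using ([]; _∷_)
  open import Data.List.Relation.Unary.Unique.Propositional using (Unique)
  import Data.List.Relation.Unary.Unique.Propositional.Properties as Unique
  open import Data.Product using (∃; _×_; _,_; proj₁)
  open import Data.Sum using ([_,_])
  open import Function using (id)
  open import Relation.Nullary using (yes; no; contradiction)
  open import Relation.Nullary.Decidable using (_×-dec_)
  open import Relation.Unary using (Decidable)
  open import Relation.Binary.PropositionalEquality hiding ([_])
  open import Defs using (rad; ABC)
  open +-*-Solver using (solve; _:*_; _:^_; _:=_)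

  private
    variable
      a b c d j k m n o p q x y N S X Z σ₁ σ₂ : ℕ
      ps : List ℕ

  prime⇒≢1 : Prime p → p ≢ 1
  prime⇒≢1 pp refl = ¬prime[1] pp

  prime∤1 : Prime p → p ∤ 1
  prime∤1 pp p∣1 = prime⇒≢1 pp (∣1⇒≡1 p∣1)

  prime∤* : Prime p → p ∤ m → p ∤ n → p ∤ m * n
  prime∤* pp p∤m p∤n p∣mn = [ p∤m , p∤n ] (euclidsLemma _ _ pp p∣mn)

  prime∣*∤⇒∣ : Prime p → p ∤ m → p ∣ m * n → p ∣ n
  prime∣*∤⇒∣ pp p∤m p∣mn = [ (λ p∣m → contradiction p∣m p∤m) , id ] (euclidsLemma _ _ pp p∣mn)

  prime∣^⇒∣ : ∀ k → Prime p → p ∣ m ^ k → p ∣ m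
  prime∣^⇒∣           zero    pp p∣1     = contradiction p∣1 (prime∤1 pp)
  prime∣^⇒∣ {m = m} (suc k) pp p∣m^1+k = [ id , prime∣^⇒∣ k pp ] (euclidsLemma m (m ^ k) pp p∣m^1+k)

  ^-monoˡ-∣ : ∀ k → d ∣ m → d ^ k ∣ m ^ k
  ^-monoˡ-∣ zero    _   = ∣-refl
  ^-monoˡ-∣ (suc k) d∣m = *-pres-∣ d∣m (^-monoˡ-∣ k d∣m)

  ^-monoʳ-∣ : ∀ p → m ≤ n → p ^ m ∣ p ^ n
  ^-monoʳ-∣ {m} p m≤n with o , refl ← m≤n⇒∃[o]m+o≡n m≤n =
    subst (p ^ m ∣_) (sym (^-distribˡ-+-* p m o)) (m∣m*n (p ^ o))

  ^-distribʳ-* : ∀ m n k → (m * n) ^ k ≡ m ^ k * n ^ k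
  ^-distribʳ-* m n zero    = refl
  ^-distribʳ-* m n (suc k) = begin
    m * n * (m * n) ^ k     ≡⟨ cong (m * n *_) (^-distribʳ-* m n k) ⟩
    m * n * (m ^ k * n ^ k) ≡⟨ solve 4 (λ m n x y → m :* n :* (x :* y) := m :* x :* (n :* y))
                                     refl m n (m ^ k) (n ^ k) ⟩
    m * m ^ k * (n * n ^ k) ∎
    where open ≡-Reasoning

  coprime-∣⇒∤ : Prime p → Coprime m n → p ∣ m → p ∤ n
  coprime-∣⇒∤ pp m⊥n p∣m p∣n = prime⇒≢1 pp (m⊥n (p∣m , p∣n))

  coprime-summand : Coprime m (m + n) → Coprime m n
  coprime-summand m⊥m+n (d∣m , d∣n) = m⊥m+n (d∣m , ∣m∣n⇒∣m+n d∣m d∣n)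

  coprime-*ʳ : Coprime m n → Coprime m o → Coprime m (n * o)
  coprime-*ʳ {m} {n} m⊥n m⊥o {d} (d∣m , d∣no) = m⊥o (d∣m , coprime-divisor d⊥n d∣no)
    where
    d⊥n : Coprime d n
    d⊥n (e∣d , e∣n) = m⊥n (∣-trans e∣d d∣m , e∣n)

  coprime-^ʳ : ∀ k → Coprime m n → Coprime m (n ^ k)
  coprime-^ʳ zero    _   (_ , d∣1) = ∣1⇒≡1 d∣1
  coprime-^ʳ (suc k) m⊥n = coprime-*ʳ m⊥n (coprime-^ʳ k m⊥n)

  coprime-^ : ∀ k l → Coprime m n → Coprime (m ^ k) (n ^ l)
  coprime-^ k l m⊥n = coprime-sym (coprime-^ʳ k (coprime-sym (coprime-^ʳ l m⊥n)))

  prime∤⇒coprime : Prime p → p ∤ m → Coprime p m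
  prime∤⇒coprime pp p∤m (d∣p , d∣m) =
    [ id , (λ d≡p → contradiction (subst (_∣ _) d≡p d∣m) p∤m) ] (prime⇒irreducible pp d∣p)

  coprime-∣⇒*∣ : Coprime m n → m ∣ o → n ∣ o → m * n ∣ o
  coprime-∣⇒*∣ {m} {n} m⊥n (divides q refl) n∣qm
    with divides r refl ← coprime-divisor (coprime-sym m⊥n) (subst (n ∣_) (*-comm q m) n∣qm) =
    divides r (trans (*-assoc r n m) (cong (r *_) (*-comm n m)))

  prime∤-cross : Prime p → x * b ≡ y * a → Coprime x y → p ∤ a → p ∤ x
  prime∤-cross {p} {x} {b} pp eq x⊥y p∤a p∣x =
    p∤a (prime∣*∤⇒∣ pp (coprime-∣⇒∤ pp x⊥y p∣x) (subst (p ∣_) eq (∣m⇒∣m*n b p∣x)))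

  distinctPrimes-coprime : Prime p → Prime q → p ≢ q → Coprime p q
  distinctPrimes-coprime pp pq p≢q = prime∤⇒coprime pp λ p∣q →
    [ prime⇒≢1 pp , p≢q ] (prime⇒irreducible pq p∣q)

  coprime-product : Prime p → All Prime ps → All (p ≢_) ps → Coprime p (product ps)
  coprime-product pp []          []            (_ , d∣1) = ∣1⇒≡1 d∣1
  coprime-product pp (pq ∷ pqs) (p≢q ∷ p≢qs) =
    coprime-*ʳ (distinctPrimes-coprime pp pq p≢q) (coprime-product pp pqs p≢qs)

  product-^∣ : ∀ k → Unique ps → All Prime ps → All (λ p → p ^ k ∣ N) ps → product ps ^ k ∣ N
  product-^∣ k [] [] [] = subst (_∣ _) (sym (^-zeroˡ k)) (1∣ _)
  product-^∣ {p ∷ ps} k (p∉ps ∷ uniq) (pp ∷ pps) (pᵏ∣N ∷ psᵏ∣N) =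
    subst (_∣ _) (sym (^-distribʳ-* p (product ps) k))
      (coprime-∣⇒*∣ (coprime-^ k k (coprime-product pp pps p∉ps)) pᵏ∣N (product-^∣ k uniq pps psᵏ∣N))

  rad^∣ : ∀ k → (∀ {p} → Prime p → p ∣ m → p ^ k ∣ N) → rad m ^ k ∣ N
  rad^∣ {m} k pᵏ∣N = product-^∣ k (Unique.filter⁺ primeDivisor? (Unique.upTo⁺ (suc m)))
    (All.map proj₁ primeDivisors) (All.map (λ (pp , p∣m) → pᵏ∣N pp p∣m) primeDivisors)
    where
    primeDivisor? : Decidable (λ p → Prime p × p ∣ m)
    primeDivisor? p = prime? p ×-dec (p ∣? m)
    primeDivisors : All (λ p → Prime p × p ∣ m) (filter primeDivisor? (upTo (suc m)))
    primeDivisors = all-filter primeDivisor? (upTo (suc m))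

  record PowerfulAwayFrom (k S m : ℕ) : Set where
    constructor powerfulAwayFrom
    field
      prime^∣ : Prime p → p ∤ S → p ∣ m → p ^ k ∣ m

  open PowerfulAwayFrom

  PowerfulAwayFrom-mono : j ≤ k → PowerfulAwayFrom k S m → PowerfulAwayFrom j S m
  PowerfulAwayFrom-mono j≤k powerful = powerfulAwayFrom λ {p} pp p∤S p∣m →
    ∣-trans (^-monoʳ-∣ p j≤k) (prime^∣ powerful pp p∤S p∣m)

  PowerfulAwayFrom-* : PowerfulAwayFrom k S m → PowerfulAwayFrom k S n → PowerfulAwayFrom k S (m * n)
  PowerfulAwayFrom-* {m = m} {n = n} powerfulₘ powerfulₙ = powerfulAwayFrom λ pp p∤S p∣mn →
    [ (λ p∣m → ∣m⇒∣m*n n (prime^∣ powerfulₘ pp p∤S p∣m))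
    , (λ p∣n → ∣n⇒∣m*n m (prime^∣ powerfulₙ pp p∤S p∣n))
    ] (euclidsLemma m n pp p∣mn)

  rad^∣S^*  : PowerfulAwayFrom k S m → rad m ^ k ∣ S ^ k * m
  rad^∣S^* {k} {S} {m} powerful = rad^∣ k pᵏ∣Sᵏm
    where
    pᵏ∣Sᵏm : Prime p → p ∣ m → p ^ k ∣ S ^ k * m
    pᵏ∣Sᵏm {p} pp p∣m with p ∣? S
    ... | yes p∣S = ∣m⇒∣m*n m (^-monoˡ-∣ k p∣S)
    ... | no  p∤S = ∣n⇒∣m*n (S ^ k) (prime^∣ powerful pp p∤S p∣m)

  cross-^∣ : ∀ n → Prime p → x * (σ₂ * Z ^ n) ≡ y * (σ₁ * X ^ n) → Coprime x y → Coprime X Z →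
             p ∤ σ₁ → p ∤ σ₂ → p ∣ x → p ^ n ∣ x
  cross-^∣ {p} {x} {σ₂} {Z} {y} {σ₁} {X} n pp eq x⊥y X⊥Z p∤σ₁ p∤σ₂ p∣x =
    coprime-divisor pⁿ⊥σ₂Zⁿ (subst (p ^ n ∣_) (*-comm x (σ₂ * Z ^ n)) pⁿ∣xσ₂Zⁿ)
    where
    p∣X : p ∣ X
    p∣X = prime∣^⇒∣ n pp (prime∣*∤⇒∣ pp p∤σ₁ (prime∣*∤⇒∣ pp (coprime-∣⇒∤ pp x⊥y p∣x)
            (subst (p ∣_) eq (∣m⇒∣m*n (σ₂ * Z ^ n) p∣x))))
    p∤σ₂Zⁿ : p ∤ σ₂ * Z ^ n
    p∤σ₂Zⁿ = prime∤* pp p∤σ₂ (λ p∣Zⁿ → coprime-∣⇒∤ pp X⊥Z p∣X (prime∣^⇒∣ n pp p∣Zⁿ))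
    pⁿ⊥σ₂Zⁿ : Coprime (p ^ n) (σ₂ * Z ^ n)
    pⁿ⊥σ₂Zⁿ = coprime-sym (coprime-^ʳ n (coprime-sym (prime∤⇒coprime pp p∤σ₂Zⁿ)))
    pⁿ∣xσ₂Zⁿ : p ^ n ∣ x * (σ₂ * Z ^ n)
    pⁿ∣xσ₂Zⁿ = subst (p ^ n ∣_) (sym eq) (∣n⇒∣m*n y (∣n⇒∣m*n σ₁ (^-monoˡ-∣ n p∣X)))

  rad[abc]^8≤ : .{{NonZero S}} → .{{NonZero (a * b * c)}} → a + b ≡ c → PowerfulAwayFrom 4 S (a * b * c) →
                rad (a * b * c) ^ 8 ≤ S ^ 8 * c ^ 6
  rad[abc]^8≤ {S} {a} {b} {c} refl powerful = begin
    r ^ 8                                       ≡⟨ ^-distribˡ-+-* r 4 4 ⟩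
    r ^ 4 * r ^ 4                               ≤⟨ *-mono-≤ r⁴≤ r⁴≤ ⟩
    S ^ 4 * (c * c * c) * (S ^ 4 * (c * c * c)) ≡⟨ solve 2 (λ s c → s :^ 4 :* (c :* c :* c) :* (s :^ 4 :* (c :* c :* c))
                                                                   := s :^ 8 :* c :^ 6) refl S c ⟩
    S ^ 8 * c ^ 6                               ∎
    where
    open ≤-Reasoning
    r = rad (a * b * c)
    instance
      Sᵏabc≢0 : NonZero (S ^ 4 * (a * b * c))
      Sᵏabc≢0 = m*n≢0 (S ^ 4) (a * b * c) {{m^n≢0 S 4}}
    r⁴≤ : r ^ 4 ≤ S ^ 4 * (c * c * c)
    r⁴≤ = begin
      r ^ 4               ≤⟨ ∣⇒≤ (rad^∣S^* powerful) ⟩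
      S ^ 4 * (a * b * c) ≤⟨ *-monoʳ-≤ (S ^ 4) (*-monoˡ-≤ c (*-mono-≤ (m≤m+n a b) (m≤n+m b a))) ⟩
      S ^ 4 * (c * c * c) ∎

  CoprimeSumsBounded : ℕ → ℕ → Set
  CoprimeSumsBounded S B = ∀ {a b c} → Coprime a b → a + b ≡ c →
    PowerfulAwayFrom 4 S a → PowerfulAwayFrom 4 S b → PowerfulAwayFrom 4 S c → c ≤ B

  abc⇒coprimeSumsBounded : ABC → .{{NonZero S}} → ∃ (CoprimeSumsBounded S)
  abc⇒coprimeSumsBounded {S} abc with K , abc[ε=1/7] ← abc 1 7 (s≤s z≤n) (s≤s z≤n) =
    suc (K * S ^ 8) , bounded
    where
    bounded : CoprimeSumsBounded S (suc (K * S ^ 8))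
    bounded {zero}         a⊥b refl _ _ _ rewrite 0-coprimeTo-m⇒m≡1 a⊥b = s≤s z≤n
    bounded {suc a} {zero} a⊥b refl _ _ _
      rewrite suc-injective (0-coprimeTo-m⇒m≡1 (coprime-sym a⊥b)) = s≤s z≤n
    bounded {a@(suc _)} {b@(suc _)} {c} a⊥b refl powerful-a powerful-b powerful-c =
      m≤n⇒m≤1+n (<⇒≤ (*-cancelʳ-< (c ^ 6) c (K * S ^ 8) (begin-strict
        c * c ^ 6               <⟨ abc[ε=1/7] a b c (s≤s z≤n) (s≤s z≤n) a⊥b refl ⟩
        K * rad (a * b * c) ^ 8 ≤⟨ *-monoʳ-≤ K (rad[abc]^8≤ {a = a} {b} refl powerful) ⟩
        K * (S ^ 8 * c ^ 6)     ≡⟨ *-assoc K (S ^ 8) (c ^ 6) ⟨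
        K * S ^ 8 * c ^ 6       ∎)))
      where
      open ≤-Reasoning
      powerful : PowerfulAwayFrom 4 S (a * b * c)
      powerful = PowerfulAwayFrom-* (PowerfulAwayFrom-* powerful-a powerful-b) powerful-c

module Rationals where

  open import Data.Nat hiding (_/_)
  open import Data.Nat.Properties
  open import Data.Nat.Divisibility
  open import Data.Nat.Primality using (Prime)
  open import Data.Nat.Coprimality using (Coprime; coprime-divisor; recompute) renaming (sym to coprime-sym)
  open import Data.Nat.ListAction using (product)
  open import Data.Nat.Solver using (module +-*-Solver)
  open import Data.Integer as ℤ using (ℤ; +_; +[1+_]; -[1+_])
  import Data.Integer.Properties as ℤ
  import Data.Integer.Divisibility.Signed as ℤ
  open import Data.Rational as ℚ using (ℚ; mkℚ; ↥_; ↧_; ↧ₙ_; 1ℚ)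
  import Data.Rational.Properties as ℚ
  import Data.Rational.Unnormalised as ℚᵘ
  open import Data.List using (List; []; _∷_; map)
  open import Data.List.Relation.Unary.All as All using (All; []; _∷_)
  open import Data.Product using (_×_; _,_)
  open import Function using (_∘_)
  open import Relation.Binary.PropositionalEquality
  open import Defs using (_^ℚ_; InSubgroup; one; mulGen; divGen)
  open Arithmetic
  open +-*-Solver using (solve; _:*_; _:=_)

  private
    variable
      a b c d k n p B S : ℕ
      A A′ : ℤ
      s : ℚ
      gens : List ℚ

  ↥ₙ_ : ℚ → ℕ
  ↥ₙ q = ℤ.∣ ↥ q ∣

  ↥ₙ⊥↧ₙ : ∀ q → Coprime (↥ₙ q) (↧ₙ q)
  ↥ₙ⊥↧ₙ (mkℚ _ _ coprime) = recompute coprime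

  -- |q| = a / b as fractions, the right-hand side not necessarily in lowest terms.
  infix 4 _≈_/_
  _≈_/_ : ℚ → ℕ → ℕ → Set
  q ≈ a / b = ↥ₙ q * b ≡ ↧ₙ q * a

  ≈-refl : ∀ q → q ≈ ↥ₙ q / ↧ₙ q
  ≈-refl q = *-comm (↥ₙ q) (↧ₙ q)

  *-≈-↥↧ : ∀ q r → q ℚ.* r ≈ (↥ₙ q * ↥ₙ r) / (↧ₙ q * ↧ₙ r)
  *-≈-↥↧ q@record{} r@record{} with ℚᵘ.*≡* eq ← ℚ.toℚᵘ-homo-* q r = begin
    ↥ₙ (q ℚ.* r) * (↧ₙ q * ↧ₙ r)         ≡⟨ ℤ.abs-* (↥ (q ℚ.* r)) (↧ q ℤ.* ↧ r) ⟨
    ℤ.∣ ↥ (q ℚ.* r) ℤ.* (↧ q ℤ.* ↧ r) ∣  ≡⟨ cong ℤ.∣_∣ cross ⟩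
    ℤ.∣ (↥ q ℤ.* ↥ r) ℤ.* ↧ (q ℚ.* r) ∣  ≡⟨ ℤ.abs-* (↥ q ℤ.* ↥ r) (↧ (q ℚ.* r)) ⟩
    ℤ.∣ ↥ q ℤ.* ↥ r ∣ * ↧ₙ (q ℚ.* r)     ≡⟨ cong (_* ↧ₙ (q ℚ.* r)) (ℤ.abs-* (↥ q) (↥ r)) ⟩
    ↥ₙ q * ↥ₙ r * ↧ₙ (q ℚ.* r)            ≡⟨ *-comm (↥ₙ q * ↥ₙ r) (↧ₙ (q ℚ.* r)) ⟩
    ↧ₙ (q ℚ.* r) * (↥ₙ q * ↥ₙ r)          ∎
    where
    open ≡-Reasoning
    cross : ↥ (q ℚ.* r) ℤ.* (↧ q ℤ.* ↧ r) ≡ (↥ q ℤ.* ↥ r) ℤ.* ↧ (q ℚ.* r)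
    cross = subst₂ (λ n d → n ℤ.* (↧ q ℤ.* ↧ r) ≡ (↥ q ℤ.* ↥ r) ℤ.* d)
              (ℚ.↥ᵘ-toℚᵘ (q ℚ.* r)) (ℚ.↧ᵘ-toℚᵘ (q ℚ.* r)) eq

  ≈-* : ∀ q r → q ≈ a / b → r ≈ c / d → q ℚ.* r ≈ (a * c) / (b * d)
  ≈-* {a} {b} {c} {d} q r q≈a/b r≈c/d = *-cancelʳ-≡ _ _ (↧ₙ q * ↧ₙ r) (begin
    ↥ₙ (q ℚ.* r) * (b * d) * (↧ₙ q * ↧ₙ r)        ≡⟨ solve 5 (λ n b d x y → n :* (b :* d) :* (x :* y) := n :* (x :* y) :* (b :* d))
                                                        refl (↥ₙ (q ℚ.* r)) b d (↧ₙ q) (↧ₙ r) ⟩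
    ↥ₙ (q ℚ.* r) * (↧ₙ q * ↧ₙ r) * (b * d)        ≡⟨ cong (_* (b * d)) (*-≈-↥↧ q r) ⟩
    ↧ₙ (q ℚ.* r) * (↥ₙ q * ↥ₙ r) * (b * d)        ≡⟨ solve 5 (λ n x y b d → n :* (x :* y) :* (b :* d) := n :* (x :* b :* (y :* d)))
                                                        refl (↧ₙ (q ℚ.* r)) (↥ₙ q) (↥ₙ r) b d ⟩
    ↧ₙ (q ℚ.* r) * (↥ₙ q * b * (↥ₙ r * d))        ≡⟨ cong₂ (λ x y → ↧ₙ (q ℚ.* r) * (x * y)) q≈a/b r≈c/d ⟩
    ↧ₙ (q ℚ.* r) * (↧ₙ q * a * (↧ₙ r * c))        ≡⟨ solve 5 (λ n x y a c → n :* (x :* a :* (y :* c)) := n :* (a :* c) :* (x :* y))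
                                                        refl (↧ₙ (q ℚ.* r)) (↧ₙ q) (↧ₙ r) a c ⟩
    ↧ₙ (q ℚ.* r) * (a * c) * (↧ₙ q * ↧ₙ r)        ∎)
    where open ≡-Reasoning

  ≈-^ : ∀ x n → x ≈ a / b → x ^ℚ n ≈ (a ^ n) / (b ^ n)
  ≈-^ x zero    _     = refl
  ≈-^ x (suc n) x≈a/b = ≈-* x (x ^ℚ n) x≈a/b (≈-^ x n x≈a/b)

  PAdicUnit : ℕ → ℚ → Set
  PAdicUnit p q = p ∤ ↥ₙ q × p ∤ ↧ₙ q

  ≈⇒PAdicUnit : ∀ q → Prime p → q ≈ a / b → p ∤ a → p ∤ b → PAdicUnit p q
  ≈⇒PAdicUnit q pp q≈a/b p∤a p∤b =
    prime∤-cross pp q≈a/b (↥ₙ⊥↧ₙ q) p∤a , prime∤-cross pp (sym q≈a/b) (coprime-sym (↥ₙ⊥↧ₙ q)) p∤b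

  PAdicUnit-1ℚ : Prime p → PAdicUnit p 1ℚ
  PAdicUnit-1ℚ pp = prime∤1 pp , prime∤1 pp

  PAdicUnit-* : ∀ q r → Prime p → PAdicUnit p q → PAdicUnit p r → PAdicUnit p (q ℚ.* r)
  PAdicUnit-* q r pp (p∤↥q , p∤↧q) (p∤↥r , p∤↧r) =
    ≈⇒PAdicUnit (q ℚ.* r) pp (*-≈-↥↧ q r) (prime∤* pp p∤↥q p∤↥r) (prime∤* pp p∤↧q p∤↧r)

  PAdicUnit-1/ : ∀ q .{{_ : ℚ.NonZero q}} → PAdicUnit p q → PAdicUnit p (ℚ.1/ q)
  PAdicUnit-1/ (mkℚ +[1+ _ ] _ _) (p∤↥q , p∤↧q) = p∤↧q , p∤↥q
  PAdicUnit-1/ (mkℚ -[1+ _ ] _ _) (p∤↥q , p∤↧q) = p∤↧q , p∤↥q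

  InSubgroup⇒PAdicUnit : Prime p → All (PAdicUnit p) gens → InSubgroup gens s → PAdicUnit p s
  InSubgroup⇒PAdicUnit pp units one = PAdicUnit-1ℚ pp
  InSubgroup⇒PAdicUnit pp units (mulGen {g} {s} g∈gens s∈Γ) =
    PAdicUnit-* g s pp (All.lookup units g∈gens) (InSubgroup⇒PAdicUnit pp units s∈Γ)
  InSubgroup⇒PAdicUnit pp units (divGen {g} {s} g∈gens s∈Γ) =
    PAdicUnit-* s (ℚ.1/ g) pp (InSubgroup⇒PAdicUnit pp units s∈Γ) (PAdicUnit-1/ g (All.lookup units g∈gens))

  ↥ₙ-nonZero : ∀ q → .{{ℚ.NonZero q}} → NonZero (↥ₙ q)
  ↥ₙ-nonZero (mkℚ +[1+ _ ] _ _) = _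
  ↥ₙ-nonZero (mkℚ -[1+ _ ] _ _) = _

  ∏↥ₙ↧ₙ : List ℚ → ℕ
  ∏↥ₙ↧ₙ gens = product (map (λ g → ↥ₙ g * ↧ₙ g) gens)

  ∏↥ₙ↧ₙ-nonZero : All ℚ.NonZero gens → NonZero (∏↥ₙ↧ₙ gens)
  ∏↥ₙ↧ₙ-nonZero []                         = _
  ∏↥ₙ↧ₙ-nonZero {g ∷ gens} (g≢0 ∷ gens≢0) =
    m*n≢0 (↥ₙ g * ↧ₙ g) (∏↥ₙ↧ₙ gens) {{m*n≢0 (↥ₙ g) (↧ₙ g) {{↥ₙ-nonZero g {{g≢0}}}}}} {{∏↥ₙ↧ₙ-nonZero gens≢0}}

  ∤∏↥ₙ↧ₙ⇒PAdicUnits : ∀ gens → p ∤ ∏↥ₙ↧ₙ gens → All (PAdicUnit p) gens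
  ∤∏↥ₙ↧ₙ⇒PAdicUnits []         _ = []
  ∤∏↥ₙ↧ₙ⇒PAdicUnits (g ∷ gens) p∤∏ =
    (p∤∏ ∘ ∣m⇒∣m*n _ ∘ ∣m⇒∣m*n (↧ₙ g) , p∤∏ ∘ ∣m⇒∣m*n _ ∘ ∣n⇒∣m*n (↥ₙ g)) ∷
    ∤∏↥ₙ↧ₙ⇒PAdicUnits gens (p∤∏ ∘ ∣n⇒∣m*n (↥ₙ g * ↧ₙ g))

  *^ℚ-powerfulAwayFrom : ∀ s x n → (∀ {p} → Prime p → p ∤ S → PAdicUnit p s) →
    PowerfulAwayFrom n S (↥ₙ (s ℚ.* x ^ℚ n)) × PowerfulAwayFrom n S (↧ₙ (s ℚ.* x ^ℚ n))
  *^ℚ-powerfulAwayFrom s x n units =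
    powerfulAwayFrom (λ pp p∤S → let p∤↥s , p∤↧s = units pp p∤S in
      cross-^∣ n pp sxⁿ≈ (↥ₙ⊥↧ₙ sxⁿ) (↥ₙ⊥↧ₙ x) p∤↥s p∤↧s) ,
    powerfulAwayFrom (λ pp p∤S → let p∤↥s , p∤↧s = units pp p∤S in
      cross-^∣ n pp (sym sxⁿ≈) (coprime-sym (↥ₙ⊥↧ₙ sxⁿ)) (coprime-sym (↥ₙ⊥↧ₙ x)) p∤↧s p∤↥s)
    where
    sxⁿ : ℚ
    sxⁿ = s ℚ.* x ^ℚ n
    sxⁿ≈ : sxⁿ ≈ (↥ₙ s * ↥ₙ x ^ n) / (↧ₙ s * ↧ₙ x ^ n)
    sxⁿ≈ = ≈-* s (x ^ℚ n) (≈-refl s) (≈-^ x n (≈-refl x))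

  InSubgroup⇒*^ℚ-powerfulAwayFrom : InSubgroup gens s → ∀ x → k ≤ n →
    PowerfulAwayFrom k (∏↥ₙ↧ₙ gens) (↥ₙ (s ℚ.* x ^ℚ n)) × PowerfulAwayFrom k (∏↥ₙ↧ₙ gens) (↧ₙ (s ℚ.* x ^ℚ n))
  InSubgroup⇒*^ℚ-powerfulAwayFrom {gens} {s} {k} {n} s∈Γ x k≤n =
    let powerful↥ , powerful↧ = *^ℚ-powerfulAwayFrom s x n units
    in PowerfulAwayFrom-mono k≤n powerful↥ , PowerfulAwayFrom-mono k≤n powerful↧
    where
    units : Prime p → p ∤ ∏↥ₙ↧ₙ gens → PAdicUnit p s
    units pp p∤∏ = InSubgroup⇒PAdicUnit pp (∤∏↥ₙ↧ₙ⇒PAdicUnits gens p∤∏) s∈Γ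

  +≡1⇒↧*↧≡↥*↧+↥*↧ : ∀ u v → u ℚ.+ v ≡ 1ℚ → ↧ u ℤ.* ↧ v ≡ ↥ u ℤ.* ↧ v ℤ.+ ↥ v ℤ.* ↧ u
  +≡1⇒↧*↧≡↥*↧+↥*↧ u@record{} v@record{} u+v≡1
    with ℚᵘ.*≡* eq ← subst (λ w → ℚ.toℚᵘ w ℚᵘ.≃ ℚ.toℚᵘ u ℚᵘ.+ ℚ.toℚᵘ v) u+v≡1 (ℚ.toℚᵘ-homo-+ u v) =
    trans (sym (ℤ.*-identityˡ _)) (trans eq (ℤ.*-identityʳ _))

  +≡1⇒↧∣↧ : ∀ u v → u ℚ.+ v ≡ 1ℚ → ↧ₙ u ∣ ↧ₙ v
  +≡1⇒↧∣↧ u v u+v≡1 =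
    coprime-divisor (coprime-sym (↥ₙ⊥↧ₙ u)) (subst (↧ₙ u ∣_) (ℤ.abs-* (↥ u) (↧ v)) (ℤ.∣⇒∣ᵤ ↧u∣↥u↧v))
    where
    ↧u∣↥u↧v : ↧ u ℤ.∣ ↥ u ℤ.* ↧ v
    ↧u∣↥u↧v = ℤ.∣m+n∣n⇒∣m (subst (↧ u ℤ.∣_) (+≡1⇒↧*↧≡↥*↧+↥*↧ u v u+v≡1) (ℤ.∣m⇒∣m*n (↧ v) ℤ.∣-refl))
                          (ℤ.∣n⇒∣m*n (↥ v) ℤ.∣-refl)

  +≡1⇒↧≡↧ : ∀ u v → u ℚ.+ v ≡ 1ℚ → ↧ₙ u ≡ ↧ₙ v
  +≡1⇒↧≡↧ u v u+v≡1 = ∣-antisym (+≡1⇒↧∣↧ u v u+v≡1) (+≡1⇒↧∣↧ v u (trans (ℚ.+-comm v u) u+v≡1))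

  +≡1⇒↥+↥≡↧ : ∀ u v → u ℚ.+ v ≡ 1ℚ → ↥ u ℤ.+ ↥ v ≡ ↧ u
  +≡1⇒↥+↥≡↧ u v u+v≡1 = ℤ.*-cancelʳ-≡ _ _ (↧ u) (begin
    (↥ u ℤ.+ ↥ v) ℤ.* ↧ u        ≡⟨ ℤ.*-distribʳ-+ (↧ u) (↥ u) (↥ v) ⟩
    ↥ u ℤ.* ↧ u ℤ.+ ↥ v ℤ.* ↧ u  ≡⟨ cong (λ d → ↥ u ℤ.* d ℤ.+ ↥ v ℤ.* ↧ u) ↧u≡↧v ⟩
    ↥ u ℤ.* ↧ v ℤ.+ ↥ v ℤ.* ↧ u  ≡⟨ +≡1⇒↧*↧≡↥*↧+↥*↧ u v u+v≡1 ⟨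
    ↧ u ℤ.* ↧ v                  ≡⟨ cong (↧ u ℤ.*_) ↧u≡↧v ⟨
    ↧ u ℤ.* ↧ u                  ∎)
    where
    open ≡-Reasoning
    ↧u≡↧v : ↧ u ≡ ↧ v
    ↧u≡↧v = cong +_ (+≡1⇒↧≡↧ u v u+v≡1)

  m-[1+n]≡o⇒o+[1+n]≡m : + a ℤ.+ -[1+ b ] ≡ + d → d + suc b ≡ a
  m-[1+n]≡o⇒o+[1+n]≡m {a} {b} {d} eq = ℤ.+-injective (begin
    + d ℤ.+ + suc b                 ≡⟨ cong (ℤ._+ + suc b) eq ⟨
    + a ℤ.+ -[1+ b ] ℤ.+ + suc b    ≡⟨ ℤ.+-assoc (+ a) -[1+ b ] (+ suc b) ⟩
    + a ℤ.+ (-[1+ b ] ℤ.+ + suc b)  ≡⟨ cong (ℤ._+_ (+ a)) (ℤ.+-inverseˡ (+ suc b)) ⟩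
    + a ℤ.+ + 0                     ≡⟨ ℤ.+-identityʳ (+ a) ⟩
    + a                             ∎)
    where open ≡-Reasoning

  summands-bounded : CoprimeSumsBounded S B → A ℤ.+ A′ ≡ + d → Coprime ℤ.∣ A ∣ d → Coprime ℤ.∣ A′ ∣ d →
    PowerfulAwayFrom 4 S ℤ.∣ A ∣ → PowerfulAwayFrom 4 S ℤ.∣ A′ ∣ → PowerfulAwayFrom 4 S d →
    ℤ.∣ A ∣ ≤ B × d ≤ B
  summands-bounded {A = + a} {+ b} bound eq a⊥d _ powerful-a powerful-b powerful-d
    with refl ← ℤ.+-injective eq =
    let a+b≤B = bound (coprime-summand a⊥d) refl powerful-a powerful-b powerful-d
    in ≤-trans (m≤m+n a b) a+b≤B , a+b≤B
  summands-bounded {A = + a} { -[1+ b ]} {d} bound eq _ 1+b⊥d powerful-a powerful-b powerful-d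
    with refl ← m-[1+n]≡o⇒o+[1+n]≡m {a} {b} eq =
    let a≤B = bound (coprime-sym 1+b⊥d) refl powerful-d powerful-b powerful-a
    in a≤B , ≤-trans (m≤m+n d (suc b)) a≤B
  summands-bounded {A = -[1+ a ]} {+ b} {d} bound eq 1+a⊥d _ powerful-a powerful-b powerful-d
    with refl ← m-[1+n]≡o⇒o+[1+n]≡m {b} {a} (trans (ℤ.+-comm (+ b) -[1+ a ]) eq) =
    let b≤B = bound (coprime-sym 1+a⊥d) refl powerful-d powerful-a powerful-b
    in ≤-trans (m≤n+m (suc a) d) b≤B , ≤-trans (m≤m+n d (suc a)) b≤B
  summands-bounded {A = -[1+ _ ]} { -[1+ _ ]} _ ()

  unitEquation-bounded : ∀ u v → CoprimeSumsBounded S B → u ℚ.+ v ≡ 1ℚ →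
    PowerfulAwayFrom 4 S (↥ₙ u) → PowerfulAwayFrom 4 S (↥ₙ v) → PowerfulAwayFrom 4 S (↧ₙ u) →
    ↥ₙ u ≤ B × ↧ₙ u ≤ B
  unitEquation-bounded u v bound u+v≡1 = summands-bounded {A = ↥ u} {↥ v} bound (+≡1⇒↥+↥≡↧ u v u+v≡1)
    (↥ₙ⊥↧ₙ u) (subst (Coprime (↥ₙ v)) (sym (+≡1⇒↧≡↧ u v u+v≡1)) (↥ₙ⊥↧ₙ v))

open import Data.Nat using (ℕ; suc; _≤_; s≤s)
open import Data.Integer as ℤ using (ℤ; +_; -[1+_])
open import Data.Rational using (ℚ; mkℚ; 1ℚ; NonZero; _+_; _*_; _-_; _/_; ↧ₙ_)
open import Data.Rational.Properties using (↥p/↧p≡p; +-0-abelianGroup)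
open import Algebra.Properties.AbelianGroup +-0-abelianGroup using (xyx⁻¹≈y)
open import Data.List using (List; map; _++_; upTo; cartesianProductWith)
open import Data.List.Relation.Unary.All using (All)
open import Data.List.Membership.Propositional using (_∈_)
open import Data.List.Membership.Propositional.Properties
  using (∈-map⁺; ∈-++⁺ˡ; ∈-++⁺ʳ; ∈-upTo⁺; ∈-cartesianProductWith⁺)
open import Data.Product using (∃; _×_; _,_)
open import Relation.Binary.PropositionalEquality using (_≡_; refl; sym; trans; cong; subst)
open import Defs
open Arithmetic using (abc⇒coprimeSumsBounded)
open Rationals using (↥ₙ_; ∏↥ₙ↧ₙ-nonZero; InSubgroup⇒*^ℚ-powerfulAwayFrom; unitEquation-bounded)

integersUpTo : ℕ → List ℤ
integersUpTo B = map +_ (upTo (suc B)) ++ map -[1+_] (upTo B)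

∈-integersUpTo : ∀ {B} A → ℤ.∣ A ∣ ≤ B → A ∈ integersUpTo B
∈-integersUpTo (+ a)     a≤B   = ∈-++⁺ˡ (∈-map⁺ +_ (∈-upTo⁺ (s≤s a≤B)))
∈-integersUpTo {B} -[1+ a ] 1+a≤B = ∈-++⁺ʳ (map +_ (upTo (suc B))) (∈-map⁺ -[1+_] (∈-upTo⁺ 1+a≤B))

heightAtMost : ℕ → List ℚ
heightAtMost B = cartesianProductWith (λ A d-1 → A / suc d-1) (integersUpTo B) (upTo B)

∈-heightAtMost : ∀ {B} q → ↥ₙ q ≤ B → ↧ₙ q ≤ B → q ∈ heightAtMost B
∈-heightAtMost q@(mkℚ A _ _) ↥ₙq≤B ↧ₙq≤B = subst (_∈ _) (↥p/↧p≡p q)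
  (∈-cartesianProductWith⁺ (λ A d-1 → A / suc d-1) (∈-integersUpTo A ↥ₙq≤B) (∈-upTo⁺ ↧ₙq≤B))

unitEquationSolutions : ℕ → List (ℚ × ℚ)
unitEquationSolutions B = map (λ u → u , 1ℚ - u) (heightAtMost B)

∈-unitEquationSolutions : ∀ {B} u v → u + v ≡ 1ℚ → ↥ₙ u ≤ B → ↧ₙ u ≤ B → (u , v) ∈ unitEquationSolutions B
∈-unitEquationSolutions u v u+v≡1 ↥ₙu≤B ↧ₙu≤B =
  subst (λ w → (u , w) ∈ _) 1-u≡v (∈-map⁺ (λ u → u , 1ℚ - u) (∈-heightAtMost u ↥ₙu≤B ↧ₙu≤B))
  where
  1-u≡v : 1ℚ - u ≡ v
  1-u≡v = trans (cong (_- u) (sym u+v≡1)) (xyx⁻¹≈y u v)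

proposition4p3 : ABC → (gens : List ℚ) → All NonZero gens →
    ∃ λ (L : List (ℚ × ℚ)) → (u v : ℚ) → u + v ≡ 1ℚ →
      (∃ λ s → ∃ λ t → ∃ λ x → ∃ λ y → ∃ λ n → ∃ λ m →
        InSubgroup gens s × InSubgroup gens t × 4 ≤ n × 4 ≤ m ×
        u ≡ s * (x ^ℚ n) × v ≡ t * (y ^ℚ m)) →
      (u , v) ∈ L
proposition4p3 abc gens gens≢0 with B , bound ← abc⇒coprimeSumsBounded abc {{∏↥ₙ↧ₙ-nonZero gens≢0}} =
  unitEquationSolutions B ,
  λ { u v u+v≡1 (s , t , x , y , n , m , s∈Γ , t∈Γ , 4≤n , 4≤m , refl , refl) →
    let powerful↥u , powerful↧u = InSubgroup⇒*^ℚ-powerfulAwayFrom s∈Γ x 4≤n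
        powerful↥v , _          = InSubgroup⇒*^ℚ-powerfulAwayFrom t∈Γ y 4≤m
        ↥ₙu≤B , ↧ₙu≤B           = unitEquation-bounded u v bound u+v≡1 powerful↥u powerful↥v powerful↧u
    in ∈-unitEquationSolutions u v u+v≡1 ↥ₙu≤B ↧ₙu≤B }
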